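{- Let $d\ge2$ be even, $x$ a positive integer and $k>1$ an integer. Suppose $\lambda_1,\ldots,\lambda_k=\textsc{Greedy}(1,F_{2d}/F_d,F_{3d}/F_d,\ldots,F_{kd}/F_d;x)$. (i) Then $0\le\lambda_i\le L_d-1$ for $1\le i<k$. (ii) If $\lambda_i=\lambda_j=L_d-1$ for some $i<j<k$, then $\lambda_t<L_d-2$ for some $t$ with $i<t<j$. Moreover, there does not exist $i<k-1$ such that $\lambda_i=\lambda_{i+1}=L_d-1$.
   Context: $F_j,L_j$ are Fibonacci and Lucas numbers ($F_0=0,F_1=1,L_0=2,L_1=1$, $X_j=X_{j-1}+X_{j-2}$); $F_d\mid F_{jd}$. For positive integers $c_1,\ldots,c_k$ and $C$, $\textsc{Greedy}(c_1,\ldots,c_k;C)=x_1^\star,\ldots,x_k^\star$ where $x_k^\star=\lfloor C/c_k\rfloor$ and $x_j^\star=\left\lfloor\big(C-\sum_{i=j+1}^kc_ix_i^\star\big)/c_j\right\rfloor$ for $j=k-1,\ldots,1$. -}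

module Defs where

open import Data.Nat using (ℕ; zero; suc; _+_; _*_; _∸_)
open import Data.Nat.DivMod using (_/_)

F : ℕ → ℕ
F zero = 0
F (suc zero) = 1
F (suc (suc n)) = F (suc n) + F n

L : ℕ → ℕ
L zero = 2
L (suc zero) = 1
L (suc (suc n)) = L (suc n) + L n

-- division of naturals, returning 0 when dividing by 0
-- (only ever applied to positive divisors in the statement)
_div_ : ℕ → ℕ → ℕ
a div zero = 0
a div (suc b) = a / suc b

-- Greedy(c 1, ..., c k ; C).
-- remG c k C m = C - Σ_{i = k-m+1}^{k} c i * x*_i  (amount left after
-- processing the m largest indices k, k-1, ..., k-m+1).
-- (the index processed at step m+1 is k - m, with x*_{k-m} = remG m / c (k-m))
remG : (ℕ → ℕ) → ℕ → ℕ → ℕ → ℕ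
remG c k C zero = C
remG c k C (suc m) = remG c k C m ∸ c (k ∸ m) * (remG c k C m div c (k ∸ m))

greedy : (ℕ → ℕ) → ℕ → ℕ → ℕ → ℕ

greedy c k C j = remG c k C (k ∸ j) div c j

fibCoeff : ℕ → ℕ → ℕ
fibCoeff d j = F (j * d) div F d

{-# OPTIONS --safe #-}
module Submission where

-- For even d the coefficients c_j = F_{jd}/F_d satisfy c_{j+2} + c_j = L_d c_{j+1}: both
-- F_{m+2d} + F_m and L_d F_{m+d} are Fibonacci-like in m, and they agree at m = 1 by
-- Cassini's identity at the odd index d - 1.  Let r_j be what the greedy algorithm has
-- left on reaching index j, so r_j = c_j λ_j + r_{j-1} and r_j < c_{j+1}.  Then
-- c_i λ_i ≤ r_i < c_{i+1} ≤ L_d c_i gives (i), and the recurrence gives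
-- r_{m+1} + s c_{m+1} ≥ c_{m+2} + c_m + r_m whenever λ_{m+1} + s ≥ L_d.  So a digit
-- L_d - 1 at m + 1 forces r_{m+1} ≥ c_{m+2} - c_{m+1}, digits ≥ L_d - 2 preserve this
-- bound, and a second digit L_d - 1 would push the residual up to c_{m+2}, which is
-- impossible.

open import Defs
open import Data.Empty using (⊥-elim)
open import Data.Nat
  using (ℕ; zero; suc; _+_; _*_; _∸_; _≤_; _<_; _≤′_; ≤′-refl; ≤′-step; z≤n; s≤s; z<s; NonZero; >-nonZero; _<?_)
open import Data.Nat.Divisibility using (_∣_; divides; _∣0; ∣-trans; m∣m*n; n∣m*n; ∣m∣n⇒∣m+n; 0∣⇒≡0)
open import Data.Nat.DivMod using (_/_; _%_; m≡m%n+[m/n]*n; m%n≡m∸m/n*n; m%n<n; m/n*n≡m; 0/n≡0; n/n≡1)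
open import Data.Nat.Properties
open import Data.Nat.Tactic.RingSolver using (solve-∀)
open import Data.Product using (_×_; _,_; ∃-syntax)
open import Data.Sum using (_⊎_; inj₁; inj₂)
open import Relation.Binary.PropositionalEquality
  using (_≡_; refl; sym; trans; cong; cong₂; subst; module ≡-Reasoning)
open import Relation.Nullary using (¬_; yes; no)

record FibonacciLike (u : ℕ → ℕ) : Set where
  constructor fibonacciLike
  field fibonacci-step : ∀ m → u (2 + m) ≡ u (1 + m) + u m

open FibonacciLike

fibonacciLike-F : FibonacciLike F
fibonacciLike-F = fibonacciLike λ _ → refl

fibonacciLike-L : FibonacciLike L
fibonacciLike-L = fibonacciLike λ _ → refl

fibonacciLike-suc : ∀ {u} → FibonacciLike u → FibonacciLike (λ m → u (suc m))
fibonacciLike-suc fu = fibonacciLike λ m → fibonacci-step fu (suc m)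

fibonacciLike-shift : ∀ {u} n → FibonacciLike u → FibonacciLike (λ m → u (m + n))
fibonacciLike-shift n fu = fibonacciLike λ m → fibonacci-step fu (m + n)

fibonacciLike-+ : ∀ {u v} → FibonacciLike u → FibonacciLike v → FibonacciLike (λ m → u m + v m)
fibonacciLike-+ {u} {v} fu fv = fibonacciLike λ m → begin
    u (2 + m) + v (2 + m)                  ≡⟨ cong₂ _+_ (fibonacci-step fu m) (fibonacci-step fv m) ⟩
    (u (1 + m) + u m) + (v (1 + m) + v m)  ≡⟨ interchange (u (1 + m)) (u m) (v (1 + m)) (v m) ⟩
    (u (1 + m) + v (1 + m)) + (u m + v m)  ∎
  where
    open ≡-Reasoning
    interchange : ∀ a b c d → (a + b) + (c + d) ≡ (a + c) + (b + d)
    interchange = solve-∀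

fibonacciLike-* : ∀ {u} a → FibonacciLike u → FibonacciLike (λ m → a * u m)
fibonacciLike-* a fu = fibonacciLike λ m → trans (cong (a *_) (fibonacci-step fu m)) (*-distribˡ-+ a _ _)

fibonacciLike-unique : ∀ {u v} → FibonacciLike u → FibonacciLike v →
                       u 0 ≡ v 0 → u 1 ≡ v 1 → ∀ m → u m ≡ v m
fibonacciLike-unique _ _ eq₀ _ zero = eq₀
fibonacciLike-unique _ _ _ eq₁ (suc zero) = eq₁
fibonacciLike-unique {u} {v} fu fv eq₀ eq₁ (suc (suc m)) = begin
    u (2 + m)        ≡⟨ fibonacci-step fu m ⟩
    u (1 + m) + u m  ≡⟨ cong₂ _+_ (agree (suc m)) (agree m) ⟩
    v (1 + m) + v m  ≡⟨ fibonacci-step fv m ⟨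
    v (2 + m)        ∎
  where
    open ≡-Reasoning
    agree : ∀ m → u m ≡ v m
    agree = fibonacciLike-unique fu fv eq₀ eq₁

F-addition : ∀ m n → F (suc (m + n)) ≡ F (suc n) * F (suc m) + F n * F m
F-addition m n = fibonacciLike-unique
  (fibonacciLike-suc (fibonacciLike-shift n fibonacciLike-F))
  (fibonacciLike-+ (fibonacciLike-* (F (suc n)) (fibonacciLike-suc fibonacciLike-F))
                   (fibonacciLike-* (F n) fibonacciLike-F))
  (sym (trans (cong₂ _+_ (*-identityʳ (F (suc n))) (*-zeroʳ (F n))) (+-identityʳ (F (suc n)))))
  (sym (cong₂ _+_ (*-identityʳ (F (suc n))) (*-identityʳ (F n))))
  m

L[1+n]≡F[2+n]+F[n] : ∀ n → L (suc n) ≡ F (2 + n) + F n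
L[1+n]≡F[2+n]+F[n] = fibonacciLike-unique
  (fibonacciLike-suc fibonacciLike-L)
  (fibonacciLike-+ (fibonacciLike-suc (fibonacciLike-suc fibonacciLike-F)) fibonacciLike-F)
  refl refl

-- Cassini's identity F_{n+1}² - F_n F_{n+2} = (-1)ⁿ, kept subtraction-free by adding
-- the 1 to the side it belongs to: each step of n moves it to the other side.
cassini-flip : ∀ n a b → F (1 + n) * F (1 + n) + a ≡ F n * F (2 + n) + b →
               F (2 + n) * F (2 + n) + b ≡ F (1 + n) * F (3 + n) + a
cassini-flip n a b eq = begin
    (y + x) * (y + x) + b            ≡⟨ expand x y b ⟩
    (y + x) * y + (x * (y + x) + b)  ≡⟨ cong ((y + x) * y +_) eq ⟨
    (y + x) * y + (y * y + a)        ≡⟨ collect x y a ⟩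
    y * ((y + x) + y) + a            ∎
  where
    open ≡-Reasoning
    x y : ℕ
    x = F n
    y = F (1 + n)
    expand : ∀ x y b → (y + x) * (y + x) + b ≡ (y + x) * y + (x * (y + x) + b)
    expand = solve-∀
    collect : ∀ x y a → (y + x) * y + (y * y + a) ≡ y * ((y + x) + y) + a
    collect = solve-∀

cassini-even : ∀ e → F (1 + e * 2) * F (1 + e * 2) + 0 ≡ F (e * 2) * F (2 + e * 2) + 1
cassini-even zero = refl
cassini-even (suc e) = cassini-flip (1 + e * 2) 1 0 (cassini-flip (e * 2) 0 1 (cassini-even e))

cassini-odd : ∀ e → F (2 + e * 2) * F (2 + e * 2) + 1 ≡ F (1 + e * 2) * F (3 + e * 2) + 0
cassini-odd e = cassini-flip (e * 2) 0 1 (cassini-even e)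

F[2n]≡L[n]*F[n] : ∀ n → F (n + n) ≡ L n * F n
F[2n]≡L[n]*F[n] zero = refl
F[2n]≡L[n]*F[n] (suc n) = begin
    F (suc (n + suc n))                        ≡⟨ F-addition n (suc n) ⟩
    F (2 + n) * F (1 + n) + F (1 + n) * F n    ≡⟨ cong (F (2 + n) * F (1 + n) +_) (*-comm (F (1 + n)) (F n)) ⟩
    F (2 + n) * F (1 + n) + F n * F (1 + n)    ≡⟨ *-distribʳ-+ (F (1 + n)) (F (2 + n)) (F n) ⟨
    (F (2 + n) + F n) * F (1 + n)              ≡⟨ cong (_* F (1 + n)) (L[1+n]≡F[2+n]+F[n] n) ⟨
    L (1 + n) * F (1 + n)                      ∎
  where open ≡-Reasoning

F[2d+1]+1≡L[d]*F[d+1] : ∀ e → let d = e * 2 in F (suc (d + d)) + 1 ≡ L d * F (suc d)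
F[2d+1]+1≡L[d]*F[d+1] zero = refl
F[2d+1]+1≡L[d]*F[d+1] (suc e) = begin
    F (suc (d + d)) + 1                        ≡⟨ cong (_+ 1) (F-addition d d) ⟩
    F (1 + d) * F (1 + d) + F d * F d + 1      ≡⟨ +-assoc (F (1 + d) * F (1 + d)) (F d * F d) 1 ⟩
    F (1 + d) * F (1 + d) + (F d * F d + 1)    ≡⟨ cong (F (1 + d) * F (1 + d) +_) cassini ⟩
    F (1 + d) * F (1 + d) + F d′ * F (1 + d)   ≡⟨ *-distribʳ-+ (F (1 + d)) (F (1 + d)) (F d′) ⟨
    (F (1 + d) + F d′) * F (1 + d)             ≡⟨ cong (_* F (1 + d)) (L[1+n]≡F[2+n]+F[n] d′) ⟨
    L d * F (1 + d)                            ∎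
  where
    open ≡-Reasoning
    d′ d : ℕ
    d′ = 1 + e * 2
    d = suc d′
    cassini : F d * F d + 1 ≡ F d′ * F (1 + d)
    cassini = trans (cassini-odd e) (+-identityʳ _)

F[m+2d]+F[m]≡L[d]*F[m+d] : ∀ e m → let d = e * 2 in F (m + (d + d)) + F m ≡ L d * F (m + d)
F[m+2d]+F[m]≡L[d]*F[m+d] e = fibonacciLike-unique
  (fibonacciLike-+ (fibonacciLike-shift (d + d) fibonacciLike-F) fibonacciLike-F)
  (fibonacciLike-* (L d) (fibonacciLike-shift d fibonacciLike-F))
  (trans (+-identityʳ _) (F[2n]≡L[n]*F[n] d))
  (F[2d+1]+1≡L[d]*F[d+1] e)
  where
    d : ℕ
    d = e * 2

F[n]∣F[m*n] : ∀ m n → F n ∣ F (m * n)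
F[n]∣F[m*n] zero n = F n ∣0
F[n]∣F[m*n] (suc m) zero = F[n]∣F[m*n] m zero
F[n]∣F[m*n] (suc m) (suc n) = subst (F (suc n) ∣_) (sym (F-addition n (m * suc n)))
  (∣m∣n⇒∣m+n (n∣m*n (F (suc (m * suc n)))) (∣-trans (F[n]∣F[m*n] m (suc n)) (m∣m*n (F n))))

0<F[1+n] : ∀ n → 0 < F (suc n)
0<F[1+n] zero = z<s
0<F[1+n] (suc n) = ≤-trans (0<F[1+n] n) (m≤m+n _ _)

0<L[n] : ∀ n → 0 < L n
0<L[n] zero = z<s
0<L[n] (suc zero) = z<s
0<L[n] (suc (suc n)) = ≤-trans (0<L[n] (suc n)) (m≤m+n _ _)

2≤L[2+n] : ∀ n → 2 ≤ L (2 + n)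
2≤L[2+n] n = +-mono-≤ (0<L[n] (suc n)) (0<L[n] n)

∣⇒n*[m-div-n]≡m : ∀ {m n} → n ∣ m → n * (m div n) ≡ m
∣⇒n*[m-div-n]≡m {n = zero} 0∣m = sym (0∣⇒≡0 0∣m)
∣⇒n*[m-div-n]≡m {m} {suc n} n∣m = trans (*-comm (suc n) (m / suc n)) (m/n*n≡m n∣m)

div≡/ : ∀ m n .{{_ : NonZero n}} → m div n ≡ m / n
div≡/ m (suc n) = refl

∸-*-div≡% : ∀ m n .{{_ : NonZero n}} → m ∸ n * (m div n) ≡ m % n
∸-*-div≡% m n@(suc _) = trans (cong (m ∸_) (*-comm n (m / n))) (sym (m%n≡m∸m/n*n m n))

module FibonacciCoefficients (e : ℕ) where

  d : ℕ
  d = suc e * 2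

  private
    c : ℕ → ℕ
    c = fibCoeff d

    instance
      F[d]≢0 : NonZero (F d)
      F[d]≢0 = >-nonZero (0<F[1+n] (suc (e * 2)))

  F[d]*c[j]≡F[j*d] : ∀ j → F d * c j ≡ F (j * d)
  F[d]*c[j]≡F[j*d] j = ∣⇒n*[m-div-n]≡m (F[n]∣F[m*n] j d)

  fibCoeff-recurrence : ∀ j → c (2 + j) + c j ≡ L d * c (1 + j)
  fibCoeff-recurrence j = *-cancelˡ-≡ _ _ (F d) (begin
      F d * (c (2 + j) + c j)          ≡⟨ *-distribˡ-+ (F d) (c (2 + j)) (c j) ⟩
      F d * c (2 + j) + F d * c j      ≡⟨ cong₂ _+_ (F[d]*c[j]≡F[j*d] (2 + j)) (F[d]*c[j]≡F[j*d] j) ⟩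
      F ((2 + j) * d) + F (j * d)      ≡⟨ cong (λ n → F n + F (j * d)) (reorder d (j * d)) ⟩
      F (j * d + (d + d)) + F (j * d)  ≡⟨ F[m+2d]+F[m]≡L[d]*F[m+d] (suc e) (j * d) ⟩
      L d * F (j * d + d)              ≡⟨ cong (λ n → L d * F n) (+-comm (j * d) d) ⟩
      L d * F ((1 + j) * d)            ≡⟨ cong (L d *_) (F[d]*c[j]≡F[j*d] (1 + j)) ⟨
      L d * (F d * c (1 + j))          ≡⟨ swap (L d) (F d) (c (1 + j)) ⟩
      F d * (L d * c (1 + j))          ∎)
    where
      open ≡-Reasoning
      reorder : ∀ x y → x + (x + y) ≡ y + (x + x)
      reorder = solve-∀
      swap : ∀ x y z → x * (y * z) ≡ y * (x * z)
      swap = solve-∀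

  fibCoeff[0]≤fibCoeff[1] : c 0 ≤ c 1
  fibCoeff[0]≤fibCoeff[1] = subst (_≤ c 1) (sym (trans (div≡/ 0 (F d)) (0/n≡0 (F d)))) z≤n

  0<fibCoeff[1] : 0 < c 1
  0<fibCoeff[1] = subst (0 <_) (sym c[1]≡1) z<s
    where
      open ≡-Reasoning
      c[1]≡1 : c 1 ≡ 1
      c[1]≡1 = begin
        F (d + 0) div F d  ≡⟨ cong (λ n → F n div F d) (+-identityʳ d) ⟩
        F d div F d        ≡⟨ div≡/ (F d) (F d) ⟩
        F d / F d          ≡⟨ n/n≡1 (F d) ⟩
        1                  ∎

  2≤L[d] : 2 ≤ L d
  2≤L[d] = 2≤L[2+n] (e * 2)

-- residual c k C j = C - Σ_{i > j} c_i x_i⋆, the amount left when the greedy algorithm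
-- reaches index j; thus greedy c k C j = residual c k C j div c j.
residual : (ℕ → ℕ) → ℕ → ℕ → ℕ → ℕ
residual c k C j = remG c k C (k ∸ j)

residual≡% : ∀ c k C j .{{_ : NonZero (c (suc j))}} → suc j ≤ k →
             residual c k C j ≡ residual c k C (suc j) % c (suc j)
residual≡% c (suc k) C j (s≤s j≤k) = begin
    remG c (suc k) C (suc k ∸ j)                            ≡⟨ cong (remG c (suc k) C) (+-∸-assoc 1 j≤k) ⟩
    R ∸ c (suc k ∸ (k ∸ j)) * (R div c (suc k ∸ (k ∸ j)))  ≡⟨ cong (λ i → R ∸ c i * (R div c i)) index ⟩
    R ∸ c (suc j) * (R div c (suc j))                      ≡⟨ ∸-*-div≡% R (c (suc j)) ⟩
    R % c (suc j)                                          ∎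
  where
    open ≡-Reasoning
    R : ℕ
    R = residual c (suc k) C (suc j)
    index : suc k ∸ (k ∸ j) ≡ suc j
    index = trans (+-∸-assoc 1 (m∸n≤m k j)) (cong suc (m∸[m∸n]≡n j≤k))

module GreedyDigits (c : ℕ → ℕ) (ℓ : ℕ) (2≤ℓ : 2 ≤ ℓ) (c₀≤c₁ : c 0 ≤ c 1) (0<c₁ : 0 < c 1)
                    (recurrence : ∀ j → c (2 + j) + c j ≡ ℓ * c (1 + j)) (k C : ℕ) where

  r λ′ : ℕ → ℕ
  r = residual c k C
  λ′ = greedy c k C

  c-mono : ∀ j → c j ≤ c (suc j)
  c-mono zero = c₀≤c₁
  c-mono (suc j) = +-cancelʳ-≤ (c j) _ _ (begin
      c (1 + j) + c j        ≤⟨ +-monoʳ-≤ (c (1 + j)) (c-mono j) ⟩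
      c (1 + j) + c (1 + j)  ≡⟨ cong (c (1 + j) +_) (+-identityʳ _) ⟨
      2 * c (1 + j)          ≤⟨ *-monoˡ-≤ (c (1 + j)) 2≤ℓ ⟩
      ℓ * c (1 + j)          ≡⟨ recurrence j ⟨
      c (2 + j) + c j        ∎)
    where open ≤-Reasoning

  0<c[1+j] : ∀ j → 0 < c (suc j)
  0<c[1+j] zero = 0<c₁
  0<c[1+j] (suc j) = <-≤-trans (0<c[1+j] j) (c-mono (suc j))

  private instance
    c[1+j]≢0 : ∀ {j} → NonZero (c (suc j))
    c[1+j]≢0 = >-nonZero (0<c[1+j] _)

  residual-suc : ∀ j → suc j ≤ k → r (suc j) ≡ r j + λ′ (suc j) * c (suc j)
  residual-suc j j<k = begin
      r (suc j)                                                ≡⟨ m≡m%n+[m/n]*n (r (suc j)) (c (suc j)) ⟩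
      r (suc j) % c (suc j) + r (suc j) / c (suc j) * c (suc j)
        ≡⟨ cong₂ (λ a b → a + b * c (suc j)) (residual≡% c k C j j<k) (div≡/ (r (suc j)) (c (suc j))) ⟨
      r j + λ′ (suc j) * c (suc j)                             ∎
    where open ≡-Reasoning

  residual-< : ∀ j → suc j ≤ k → r j < c (suc j)
  residual-< j j<k = subst (_< c (suc j)) (sym (residual≡% c k C j j<k)) (m%n<n _ _)

  λ′<ℓ : ∀ j → suc j < k → λ′ (suc j) < ℓ
  λ′<ℓ j 1+j<k = *-cancelʳ-< (c (suc j)) _ _ (begin-strict
      λ′ (1 + j) * c (1 + j)        ≤⟨ m≤n+m _ (r j) ⟩
      r j + λ′ (1 + j) * c (1 + j)  ≡⟨ residual-suc j (<⇒≤ 1+j<k) ⟨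
      r (1 + j)                     <⟨ residual-< (suc j) 1+j<k ⟩
      c (2 + j)                     ≤⟨ m≤m+n _ (c j) ⟩
      c (2 + j) + c j               ≡⟨ recurrence j ⟩
      ℓ * c (1 + j)                 ∎)
    where open ≤-Reasoning

  digit≤ℓ∸1 : ∀ i → 1 ≤ i → i < k → λ′ i ≤ ℓ ∸ 1
  digit≤ℓ∸1 (suc j) _ 1+j<k = ∸-monoˡ-≤ 1 (λ′<ℓ j 1+j<k)

  residual-lower-bound : ∀ m s → suc m ≤ k → ℓ ≤ s + λ′ (suc m) →
                         c (2 + m) + c m + r m ≤ r (suc m) + s * c (suc m)
  residual-lower-bound m s 1+m≤k ℓ≤s+λ′ = begin
      c (2 + m) + c m + r m                  ≡⟨ cong (_+ r m) (recurrence m) ⟩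
      ℓ * c (1 + m) + r m                    ≤⟨ +-monoˡ-≤ (r m) (*-monoˡ-≤ (c (1 + m)) ℓ≤s+λ′) ⟩
      (s + λ′ (1 + m)) * c (1 + m) + r m     ≡⟨ regroup s (λ′ (1 + m)) (c (1 + m)) (r m) ⟩
      r m + λ′ (1 + m) * c (1 + m) + s * c (1 + m)
        ≡⟨ cong (_+ s * c (1 + m)) (residual-suc m 1+m≤k) ⟨
      r (1 + m) + s * c (1 + m)              ∎
    where
      open ≤-Reasoning
      regroup : ∀ s x y z → (s + x) * y + z ≡ z + x * y + s * y
      regroup = solve-∀

  Saturated : ℕ → Set
  Saturated m = c (suc m) ≤ r m + c m

  saturated-start : ∀ m → suc m ≤ k → ℓ ≤ 1 + λ′ (suc m) → Saturated (suc m)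
  saturated-start m 1+m≤k ℓ≤1+λ′ = begin
      c (2 + m)                  ≤⟨ ≤-trans (m≤m+n _ (c m)) (m≤m+n _ (r m)) ⟩
      c (2 + m) + c m + r m      ≤⟨ residual-lower-bound m 1 1+m≤k ℓ≤1+λ′ ⟩
      r (1 + m) + 1 * c (1 + m)  ≡⟨ cong (r (1 + m) +_) (*-identityˡ _) ⟩
      r (1 + m) + c (1 + m)      ∎
    where open ≤-Reasoning

  saturated-bound : ∀ m s → Saturated m → suc m ≤ k → ℓ ≤ s + λ′ (suc m) →
                    c (2 + m) + c (1 + m) ≤ r (1 + m) + s * c (1 + m)
  saturated-bound m s sat 1+m≤k ℓ≤s+λ′ = begin
      c (2 + m) + c (1 + m)      ≤⟨ +-monoʳ-≤ (c (2 + m)) sat ⟩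
      c (2 + m) + (r m + c m)    ≡⟨ cong (c (2 + m) +_) (+-comm (r m) (c m)) ⟩
      c (2 + m) + (c m + r m)    ≡⟨ +-assoc (c (2 + m)) (c m) (r m) ⟨
      c (2 + m) + c m + r m      ≤⟨ residual-lower-bound m s 1+m≤k ℓ≤s+λ′ ⟩
      r (1 + m) + s * c (1 + m)  ∎
    where open ≤-Reasoning

  saturated-step : ∀ m → Saturated m → suc m ≤ k → ℓ ≤ 2 + λ′ (suc m) → Saturated (suc m)
  saturated-step m sat 1+m≤k ℓ≤2+λ′ = +-cancelʳ-≤ (c (1 + m)) _ _ (begin
      c (2 + m) + c (1 + m)                  ≤⟨ saturated-bound m 2 sat 1+m≤k ℓ≤2+λ′ ⟩
      r (1 + m) + 2 * c (1 + m)              ≡⟨ split (r (1 + m)) (c (1 + m)) ⟩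
      r (1 + m) + c (1 + m) + c (1 + m)      ∎)
    where
      open ≤-Reasoning
      split : ∀ a b → a + 2 * b ≡ a + b + b
      split = solve-∀

  saturated-blocks : ∀ m → Saturated m → suc m < k → ¬ (ℓ ≤ 1 + λ′ (suc m))
  saturated-blocks m sat 1+m<k ℓ≤1+λ′ = <⇒≱ (residual-< (suc m) 1+m<k)
    (+-cancelʳ-≤ (c (1 + m)) _ _
      (subst (c (2 + m) + c (1 + m) ≤_) (cong (r (1 + m) +_) (*-identityˡ _))
        (saturated-bound m 1 sat (<⇒≤ 1+m<k) ℓ≤1+λ′)))

  saturated-or-small-digit : ∀ {p m} → suc p ≤′ m → m < k → ℓ ≤ 1 + λ′ (suc p) →
    (∃[ t ] (suc p < t × t ≤ m × λ′ t < ℓ ∸ 2)) ⊎ Saturated m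
  saturated-or-small-digit {p} ≤′-refl m<k ℓ≤1+λ′ = inj₂ (saturated-start p (<⇒≤ m<k) ℓ≤1+λ′)
  saturated-or-small-digit (≤′-step {n} p<n) m<k ℓ≤1+λ′
    with saturated-or-small-digit p<n (<-trans (n<1+n n) m<k) ℓ≤1+λ′
  ... | inj₁ (t , p<t , t≤n , small) = inj₁ (t , p<t , m≤n⇒m≤1+n t≤n , small)
  ... | inj₂ sat with λ′ (suc n) <? ℓ ∸ 2
  ...   | yes small = inj₁ (suc n , s≤s (≤′⇒≤ p<n) , ≤-refl , small)
  ...   | no ¬small = inj₂ (saturated-step n sat (<⇒≤ m<k)
                               (≤-trans (m≤n+m∸n ℓ 2) (+-monoʳ-≤ 2 (≮⇒≥ ¬small))))

  maximal⇒ℓ≤1+ : ∀ {x} → x ≡ ℓ ∸ 1 → ℓ ≤ 1 + x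
  maximal⇒ℓ≤1+ refl = m≤n+m∸n ℓ 1

  maximal-digits-separated : (i j : ℕ) → 1 ≤ i → i < j → j < k →
    λ′ i ≡ ℓ ∸ 1 → λ′ j ≡ ℓ ∸ 1 → ∃[ t ] (i < t × t < j × λ′ t < ℓ ∸ 2)
  maximal-digits-separated (suc p) (suc n) _ (s≤s p<n) j<k maxᵢ maxⱼ
    with saturated-or-small-digit (≤⇒≤′ p<n) (<-trans (n<1+n n) j<k) (maximal⇒ℓ≤1+ maxᵢ)
  ... | inj₁ (t , p<t , t≤n , small) = t , p<t , s≤s t≤n , small
  ... | inj₂ sat = ⊥-elim (saturated-blocks n sat j<k (maximal⇒ℓ≤1+ maxⱼ))

  no-adjacent-maximal-digits : ¬ (∃[ i ] (1 ≤ i × i < k ∸ 1 × λ′ i ≡ ℓ ∸ 1 × λ′ (i + 1) ≡ ℓ ∸ 1))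
  no-adjacent-maximal-digits (i , 1≤i , i<k∸1 , maxᵢ , maxᵢ₊₁) =
    let t , i<t , t<i+1 , _ = maximal-digits-separated i (i + 1) 1≤i i<i+1 i+1<k maxᵢ maxᵢ₊₁
    in <⇒≱ t<i+1 (subst (_≤ t) (+-comm 1 i) i<t)
    where
      i<i+1 : i < i + 1
      i<i+1 = subst (i <_) (+-comm 1 i) (n<1+n i)
      i+1<k : i + 1 < k
      i+1<k = m≤o∸n⇒m+n≤o (suc i) (≤-trans (s≤s z≤n) (≤-trans i<k∸1 (m∸n≤m k 1))) i<k∸1

proposition3p2p3 : (d x k : ℕ) → 2 ≤ d → 2 ∣ d → 1 ≤ x → 1 < k →
    let λ′ = greedy (fibCoeff d) k x in
    ((i : ℕ) → 1 ≤ i → i < k → 0 ≤ λ′ i × λ′ i ≤ L d ∸ 1)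
    × ((i j : ℕ) → 1 ≤ i → i < j → j < k →
        λ′ i ≡ L d ∸ 1 → λ′ j ≡ L d ∸ 1 →
        ∃[ t ] (i < t × t < j × λ′ t < L d ∸ 2))
    × ¬ (∃[ i ] (1 ≤ i × i < k ∸ 1 × λ′ i ≡ L d ∸ 1 × λ′ (i + 1) ≡ L d ∸ 1))
proposition3p2p3 _ _ _ () (divides zero refl) _ _
proposition3p2p3 _ x k _ (divides (suc e) refl) _ _ =
  (λ i 1≤i i<k → z≤n , digit≤ℓ∸1 i 1≤i i<k) , maximal-digits-separated , no-adjacent-maximal-digits
  where
    open FibonacciCoefficients e
    open GreedyDigits (fibCoeff d) (L d) 2≤L[d] fibCoeff[0]≤fibCoeff[1] 0<fibCoeff[1] fibCoeff-recurrence k x
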